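{- Let $c,d\in\mathbb{Z}[x]$ with $c(0)\neq0$, $d(0)\neq0$, and assume $(c,d)$ is weakly robust. Then there is an integer \[ m_0\le(1+\deg c+\deg d)\,2^{\|c\|+\|d\|-1}\] such that for all $m>m_0$: if $a,b\in\mathbb{Z}[x]$ with $\deg a,\deg b<m$ satisfy $(ab)|_m=cd$, then $ab=cd$ or $\|a\|+\|b\|>\|c\|+\|d\|$.
   Context: $\|f\|$ is the sum of squares of the coefficients of $f\in\mathbb{Z}[x]$; $f|_m$ is the remainder of $f$ upon division by $x^m$. The pair $(c,d)$ is weakly robust if for all $a,b\in\mathbb{Z}[x]$ with $ab=cd$ one has $\|a\|+\|b\|\ge\|c\|+\|d\|-1$. -}

module Defs where

open import Data.Nat using (ℕ; zero; suc; _≤_) renaming (_+_ to _+ℕ_; _*_ to _*ℕ_; _∸_ to _∸ℕ_)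
open import Data.Integer using (ℤ; +_; ∣_∣) renaming (_+_ to _+ℤ_; _*_ to _*ℤ_)
open import Data.List using (List; []; _∷_; map; length; take)
open import Relation.Binary.PropositionalEquality using (_≡_)

-- Integer polynomials ℤ[x] as coefficient lists, lowest degree first.
-- Trailing zeros are allowed; polynomial equality is coefficientwise (_≈_).
Poly : Set
Poly = List ℤ

coeff : Poly → ℕ → ℤ
coeff []       n       = + 0
coeff (x ∷ p)  zero    = x
coeff (x ∷ p)  (suc n) = coeff p n

_≈_ : Poly → Poly → Set
f ≈ g = ∀ n → coeff f n ≡ coeff g n

infix 4 _≈_

_⊕_ : Poly → Poly → Poly
[]      ⊕ q       = q
(x ∷ p) ⊕ []      = x ∷ p
(x ∷ p) ⊕ (y ∷ q) = (x +ℤ y) ∷ (p ⊕ q)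

_⊛_ : Poly → Poly → Poly
[]      ⊛ q = []
(x ∷ p) ⊛ q = map (x *ℤ_) q ⊕ (+ 0 ∷ (p ⊛ q))

infixl 7 _⊛_
infixl 6 _⊕_

‖_‖ : Poly → ℕ
‖ [] ‖    = 0
‖ x ∷ p ‖ = ∣ x ∣ *ℕ ∣ x ∣ +ℕ ‖ p ‖

-- f|_m : remainder of f upon division by x^m (keep coefficients of x^0..x^(m-1))
_∣ₜ_ : Poly → ℕ → Poly
f ∣ₜ m = take m f

strip : Poly → Poly
strip [] = []
strip (x ∷ p) with strip p
strip (+ zero ∷ p) | [] = []
strip (x ∷ p)      | [] = x ∷ []
strip (x ∷ p)      | q ∷ qs = x ∷ q ∷ qs

-- degree (for the zero polynomial this gives 0; only used on nonzero polynomials)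
deg : Poly → ℕ
deg f = length (strip f) ∸ℕ 1

-- deg f < m (with deg 0 = -∞): all coefficients from x^m on vanish
DegLt : Poly → ℕ → Set
DegLt f m = ∀ n → m ≤ n → coeff f n ≡ + 0

WeaklyRobust : Poly → Poly → Set
WeaklyRobust c d = ∀ (a b : Poly) → a ⊛ b ≈ c ⊛ d → (‖ c ‖ +ℕ ‖ d ‖) ∸ℕ 1 ≤ ‖ a ‖ +ℕ ‖ b ‖

module Submission where

-- Put N = ‖c‖ + ‖d‖, L = 1 + deg c + deg d and m₀ = L·2^(N-1).  If ‖a‖ + ‖b‖ > N we are done, so
-- assume ‖a‖ + ‖b‖ ≤ N.
--  (1) Gap search.  The weight ‖·‖ of a and b from x^s on drops by at least one
--      each time s doubles, unless a and b both vanish in degrees [s, 2s).  As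
--      a(0), b(0) ≠ 0, the weight from x^L on is at most N - 2, so such a gap
--      occurs for some L ≤ s ≤ L·2^(N-2); in particular 2s < m.
--  (2) Below x^(2s) the product ab only sees the truncations a₁ = a|_s, b₁ = b|_s;
--      since deg(a₁b₁) and deg(cd) are below 2s, this gives a₁b₁ = cd.
--  (3) Weak robustness gives ‖a₁‖ + ‖b₁‖ ≥ N - 1, so one of the tails a - a₁,
--      b - b₁ is zero, say b = b₁.  Then (a - a₁)b₁ ≡ 0 (mod x^m) with b₁(0) ≠ 0,
--      so a - a₁ ≡ 0 (mod x^m); as deg a < m, a = a₁ and ab = a₁b₁ = cd.
-- The file develops coefficient arithmetic of ⊕ and ⊛, divisibility by powers
-- of x, degree bounds, truncations and norms, then steps (1)-(3), and finally
-- derives the corollary.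

open import Defs
open import Data.Nat using (ℕ; suc; _^_) renaming (_+_ to _+ℕ_; _*_ to _*ℕ_; _∸_ to _∸ℕ_; _<_ to _<ℕ_)
open import Data.Integer using (ℤ; +_; _≤_; _<_)
open import Data.Product using (Σ; _×_)
open import Data.Sum using (_⊎_)
open import Relation.Binary.PropositionalEquality using (_≢_)

open import Level using (0ℓ)
open import Data.Nat using (zero; z≤n; s≤s) renaming (_≤_ to _≤ℕ_)
import Data.Nat.Properties as ℕP
import Data.Nat.Tactic.RingSolver as ℕSolver
open import Data.Integer using (-[1+_]; ∣_∣) renaming (_+_ to _+ℤ_; _*_ to _*ℤ_)
import Data.Integer.Properties as ℤP
import Data.Integer.Tactic.RingSolver as ℤSolver
open import Algebra.Properties.AbelianGroup ℤP.+-0-abelianGroup using (identityʳ-unique)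
open import Data.List using ([]; _∷_; map; length; take)
open import Data.Product using (_,_)
open import Data.Sum using (inj₁; inj₂; [_,_]′)
open import Data.Empty using (⊥-elim)
open import Function using (id)
open import Relation.Nullary using (yes; no)
open import Relation.Binary.Bundles using (Setoid)
open import Relation.Binary.PropositionalEquality
  using (_≡_; refl; sym; trans; cong; cong₂; module ≡-Reasoning)
import Relation.Binary.Reasoning.Setoid as SetoidReasoning

coeff-⊕ : ∀ p q n → coeff (p ⊕ q) n ≡ coeff p n +ℤ coeff q n
coeff-⊕ []      q       n       = sym (ℤP.+-identityˡ _)
coeff-⊕ (x ∷ p) []      n       = sym (ℤP.+-identityʳ _)
coeff-⊕ (x ∷ p) (y ∷ q) zero    = refl
coeff-⊕ (x ∷ p) (y ∷ q) (suc n) = coeff-⊕ p q n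

coeff-scale : ∀ x q n → coeff (map (x *ℤ_) q) n ≡ x *ℤ coeff q n
coeff-scale x []      n       = sym (ℤP.*-zeroʳ x)
coeff-scale x (y ∷ q) zero    = refl
coeff-scale x (y ∷ q) (suc n) = coeff-scale x q n

coeff-∷⊛-zero : ∀ x p q → coeff ((x ∷ p) ⊛ q) zero ≡ x *ℤ coeff q zero
coeff-∷⊛-zero x p q = begin
  coeff (map (x *ℤ_) q ⊕ (+ 0 ∷ p ⊛ q)) zero  ≡⟨ coeff-⊕ (map (x *ℤ_) q) (+ 0 ∷ p ⊛ q) zero ⟩
  coeff (map (x *ℤ_) q) zero +ℤ + 0          ≡⟨ ℤP.+-identityʳ _ ⟩
  coeff (map (x *ℤ_) q) zero                 ≡⟨ coeff-scale x q zero ⟩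
  x *ℤ coeff q zero                          ∎
  where open ≡-Reasoning

coeff-∷⊛-suc : ∀ x p q n →
  coeff ((x ∷ p) ⊛ q) (suc n) ≡ x *ℤ coeff q (suc n) +ℤ coeff (p ⊛ q) n
coeff-∷⊛-suc x p q n = begin
  coeff (map (x *ℤ_) q ⊕ (+ 0 ∷ p ⊛ q)) (suc n)     ≡⟨ coeff-⊕ (map (x *ℤ_) q) (+ 0 ∷ p ⊛ q) (suc n) ⟩
  coeff (map (x *ℤ_) q) (suc n) +ℤ coeff (p ⊛ q) n  ≡⟨ cong (_+ℤ coeff (p ⊛ q) n) (coeff-scale x q (suc n)) ⟩
  x *ℤ coeff q (suc n) +ℤ coeff (p ⊛ q) n           ∎
  where open ≡-Reasoning

≈-setoid : Setoid 0ℓ 0ℓ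
≈-setoid = record
  { Carrier       = Poly
  ; _≈_           = _≈_
  ; isEquivalence = record
    { refl  = λ n → refl
    ; sym   = λ e n → sym (e n)
    ; trans = λ e f n → trans (e n) (f n)
    }
  }

⊕-cong : ∀ p p′ q q′ → p ≈ p′ → q ≈ q′ → p ⊕ q ≈ p′ ⊕ q′
⊕-cong p p′ q q′ e f n =
  trans (coeff-⊕ p q n) (trans (cong₂ _+ℤ_ (e n) (f n)) (sym (coeff-⊕ p′ q′ n)))

⊕-zeroʳ : ∀ p {q} → q ≈ [] → p ⊕ q ≈ p
⊕-zeroʳ p {q} z n = trans (coeff-⊕ p q n) (trans (cong (coeff p n +ℤ_) (z n)) (ℤP.+-identityʳ _))

⊛-zeroˡ : ∀ p q → p ≈ [] → p ⊛ q ≈ []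
⊛-zeroˡ []      q z n = refl
⊛-zeroˡ (x ∷ p) q z zero    rewrite coeff-∷⊛-zero x p q | z zero = refl
⊛-zeroˡ (x ∷ p) q z (suc n) rewrite coeff-∷⊛-suc x p q n | z zero
                                  | ⊛-zeroˡ p q (λ k → z (suc k)) n = refl

⊛-congˡ : ∀ p p′ q → p ≈ p′ → p ⊛ q ≈ p′ ⊛ q
⊛-congˡ []      p′       q e n = sym (⊛-zeroˡ p′ q (λ k → sym (e k)) n)
⊛-congˡ (x ∷ p) []       q e = ⊛-zeroˡ (x ∷ p) q e
⊛-congˡ (x ∷ p) (y ∷ p′) q e zero
  rewrite coeff-∷⊛-zero x p q | coeff-∷⊛-zero y p′ q | e zero = refl
⊛-congˡ (x ∷ p) (y ∷ p′) q e (suc n)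
  rewrite coeff-∷⊛-suc x p q n | coeff-∷⊛-suc y p′ q n | e zero
        | ⊛-congˡ p p′ q (λ k → e (suc k)) n = refl

⊛-congʳ : ∀ p q q′ → q ≈ q′ → p ⊛ q ≈ p ⊛ q′
⊛-congʳ []      q q′ e n = refl
⊛-congʳ (x ∷ p) q q′ e zero
  rewrite coeff-∷⊛-zero x p q | coeff-∷⊛-zero x p q′ | e zero = refl
⊛-congʳ (x ∷ p) q q′ e (suc n)
  rewrite coeff-∷⊛-suc x p q n | coeff-∷⊛-suc x p q′ n | e (suc n) | ⊛-congʳ p q q′ e n = refl

⊛-distribʳ : ∀ p p′ q → (p ⊕ p′) ⊛ q ≈ p ⊛ q ⊕ p′ ⊛ q
⊛-distribʳ p p′ q n = trans (distrib p p′ n) (sym (coeff-⊕ (p ⊛ q) (p′ ⊛ q) n))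
  where
  rearrange : ∀ x y z u v → (x +ℤ y) *ℤ z +ℤ (u +ℤ v) ≡ (x *ℤ z +ℤ u) +ℤ (y *ℤ z +ℤ v)
  rearrange = ℤSolver.solve-∀
  distrib : ∀ p p′ n → coeff ((p ⊕ p′) ⊛ q) n ≡ coeff (p ⊛ q) n +ℤ coeff (p′ ⊛ q) n
  distrib []      p′       n = sym (ℤP.+-identityˡ _)
  distrib (x ∷ p) []       n = sym (ℤP.+-identityʳ _)
  distrib (x ∷ p) (y ∷ p′) zero
    rewrite coeff-∷⊛-zero (x +ℤ y) (p ⊕ p′) q | coeff-∷⊛-zero x p q | coeff-∷⊛-zero y p′ q
    = ℤP.*-distribʳ-+ (coeff q 0) x y
  distrib (x ∷ p) (y ∷ p′) (suc n)
    rewrite coeff-∷⊛-suc (x +ℤ y) (p ⊕ p′) q n | coeff-∷⊛-suc x p q n | coeff-∷⊛-suc y p′ q n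
          | distrib p p′ n
    = rearrange x y (coeff q (suc n)) (coeff (p ⊛ q) n) (coeff (p′ ⊛ q) n)

⊛-distribˡ : ∀ p q q′ → p ⊛ (q ⊕ q′) ≈ p ⊛ q ⊕ p ⊛ q′
⊛-distribˡ p q q′ n = trans (distrib p n) (sym (coeff-⊕ (p ⊛ q) (p ⊛ q′) n))
  where
  rearrange : ∀ x y z u v → x *ℤ (y +ℤ z) +ℤ (u +ℤ v) ≡ (x *ℤ y +ℤ u) +ℤ (x *ℤ z +ℤ v)
  rearrange = ℤSolver.solve-∀
  distrib : ∀ p n → coeff (p ⊛ (q ⊕ q′)) n ≡ coeff (p ⊛ q) n +ℤ coeff (p ⊛ q′) n
  distrib []      n = refl
  distrib (x ∷ p) zero
    rewrite coeff-∷⊛-zero x p (q ⊕ q′) | coeff-∷⊛-zero x p q | coeff-∷⊛-zero x p q′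
          | coeff-⊕ q q′ zero
    = ℤP.*-distribˡ-+ x (coeff q 0) (coeff q′ 0)
  distrib (x ∷ p) (suc n)
    rewrite coeff-∷⊛-suc x p (q ⊕ q′) n | coeff-∷⊛-suc x p q n | coeff-∷⊛-suc x p q′ n
          | distrib p n | coeff-⊕ q q′ (suc n)
    = rearrange x (coeff q (suc n)) (coeff q′ (suc n)) (coeff (p ⊛ q) n) (coeff (p ⊛ q′) n)

⊛-expand : ∀ a a₁ a₂ b b₁ b₂ → a ≈ a₁ ⊕ a₂ → b ≈ b₁ ⊕ b₂ →
  a ⊛ b ≈ (a₁ ⊛ b₁ ⊕ a₁ ⊛ b₂) ⊕ (a₂ ⊛ b₁ ⊕ a₂ ⊛ b₂)
⊛-expand a a₁ a₂ b b₁ b₂ ea eb = begin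
  a ⊛ b                                        ≈⟨ ⊛-congˡ a (a₁ ⊕ a₂) b ea ⟩
  (a₁ ⊕ a₂) ⊛ b                                ≈⟨ ⊛-distribʳ a₁ a₂ b ⟩
  a₁ ⊛ b ⊕ a₂ ⊛ b                              ≈⟨ ⊕-cong (a₁ ⊛ b) (a₁ ⊛ (b₁ ⊕ b₂)) (a₂ ⊛ b) (a₂ ⊛ (b₁ ⊕ b₂))
                                                     (⊛-congʳ a₁ b (b₁ ⊕ b₂) eb) (⊛-congʳ a₂ b (b₁ ⊕ b₂) eb) ⟩
  a₁ ⊛ (b₁ ⊕ b₂) ⊕ a₂ ⊛ (b₁ ⊕ b₂)              ≈⟨ ⊕-cong (a₁ ⊛ (b₁ ⊕ b₂)) (a₁ ⊛ b₁ ⊕ a₁ ⊛ b₂) (a₂ ⊛ (b₁ ⊕ b₂)) (a₂ ⊛ b₁ ⊕ a₂ ⊛ b₂)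
                                                     (⊛-distribˡ a₁ b₁ b₂) (⊛-distribˡ a₂ b₁ b₂) ⟩
  (a₁ ⊛ b₁ ⊕ a₁ ⊛ b₂) ⊕ (a₂ ⊛ b₁ ⊕ a₂ ⊛ b₂)    ∎
  where open SetoidReasoning ≈-setoid

AgreeBelow : ℕ → Poly → Poly → Set
AgreeBelow m p q = ∀ n → n <ℕ m → coeff p n ≡ coeff q n

x^_∣_ : ℕ → Poly → Set
x^ k ∣ p = AgreeBelow k p []

infix 4 x^_∣_

∣-⊛ˡ : ∀ k p q → x^ k ∣ p → x^ k ∣ p ⊛ q
∣-⊛ˡ k       []      q dvd n       l       = refl
∣-⊛ˡ (suc k) (x ∷ p) q dvd zero    l       rewrite coeff-∷⊛-zero x p q | dvd zero l = refl
∣-⊛ˡ (suc k) (x ∷ p) q dvd (suc n) (s≤s l) rewrite coeff-∷⊛-suc x p q n | dvd zero (s≤s z≤n)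
  | ∣-⊛ˡ k p q (λ i i<k → dvd (suc i) (s≤s i<k)) n l = refl

∣-⊛ʳ : ∀ k p q → x^ k ∣ q → x^ k ∣ p ⊛ q
∣-⊛ʳ k []      q dvd n       l = refl
∣-⊛ʳ k (x ∷ p) q dvd zero    l rewrite coeff-∷⊛-zero x p q | dvd zero l = ℤP.*-zeroʳ x
∣-⊛ʳ k (x ∷ p) q dvd (suc n) l rewrite coeff-∷⊛-suc x p q n | dvd (suc n) l
  | ∣-⊛ʳ k p q dvd n (ℕP.<-trans (ℕP.n<1+n n) l) = trans (ℤP.+-identityʳ _) (ℤP.*-zeroʳ x)

lowest-coeffˡ : ∀ k p q → x^ k ∣ p → coeff (p ⊛ q) k ≡ coeff p k *ℤ coeff q 0
lowest-coeffˡ k       []      q dvd = refl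
lowest-coeffˡ zero    (x ∷ p) q dvd = coeff-∷⊛-zero x p q
lowest-coeffˡ (suc k) (x ∷ p) q dvd rewrite coeff-∷⊛-suc x p q k | dvd zero (s≤s z≤n)
  | lowest-coeffˡ k p q (λ i i<k → dvd (suc i) (s≤s i<k)) = ℤP.+-identityˡ _

lowest-coeffʳ : ∀ k p q → x^ k ∣ q → coeff (p ⊛ q) k ≡ coeff p 0 *ℤ coeff q k
lowest-coeffʳ k       []      q dvd = refl
lowest-coeffʳ zero    (x ∷ p) q dvd = coeff-∷⊛-zero x p q
lowest-coeffʳ (suc k) (x ∷ p) q dvd rewrite coeff-∷⊛-suc x p q k
  | ∣-⊛ʳ (suc k) p q dvd k (ℕP.n<1+n k) = ℤP.+-identityʳ _

∣-by-lowest-coeff : ∀ m t u → u ≢ + 0 →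
  (∀ k → k <ℕ m → x^ k ∣ t → coeff t k *ℤ u ≡ + 0) → x^ m ∣ t
∣-by-lowest-coeff (suc m) t u u≢0 step n n<1+m with ℕP.m≤n⇒m<n∨m≡n (ℕP.≤-pred n<1+m)
... | inj₁ n<m  = ∣-by-lowest-coeff m t u u≢0 (λ k k<m → step k (ℕP.m<n⇒m<1+n k<m)) n n<m
... | inj₂ refl = [ id , (λ u≡0 → ⊥-elim (u≢0 u≡0)) ]′
                    (ℤP.i*j≡0⇒i≡0∨j≡0 (coeff t n) (step n n<1+m below-n))
  where
  below-n : x^ n ∣ t
  below-n = ∣-by-lowest-coeff n t u u≢0 (λ k k<n → step k (ℕP.m<n⇒m<1+n k<n))

unit-cancelˡ : ∀ m t q → coeff q 0 ≢ + 0 → x^ m ∣ t ⊛ q → x^ m ∣ t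
unit-cancelˡ m t q q₀≢0 dvd = ∣-by-lowest-coeff m t (coeff q 0) q₀≢0
  (λ k k<m t-low → trans (sym (lowest-coeffˡ k t q t-low)) (dvd k k<m))

unit-cancelʳ : ∀ m t q → coeff q 0 ≢ + 0 → x^ m ∣ q ⊛ t → x^ m ∣ t
unit-cancelʳ m t q q₀≢0 dvd = ∣-by-lowest-coeff m t (coeff q 0) q₀≢0
  (λ k k<m t-low → trans (ℤP.*-comm (coeff t k) (coeff q 0))
                         (trans (sym (lowest-coeffʳ k q t t-low)) (dvd k k<m)))

∣-degLt⇒zero : ∀ m p → x^ m ∣ p → DegLt p m → p ≈ []
∣-degLt⇒zero m p dvd lt n with n ℕP.<? m
... | yes n<m = dvd n n<m
... | no  n≮m = lt n (ℕP.≮⇒≥ n≮m)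

degLt-mono : ∀ p {i j} → i ≤ℕ j → DegLt p i → DegLt p j
degLt-mono p i≤j lt n j≤n = lt n (ℕP.≤-trans i≤j j≤n)

⊛-degLt : ∀ p q i j → DegLt p i → DegLt q j → DegLt (p ⊛ q) (i +ℕ j)
⊛-degLt []      q i       j lp lq n       l = refl
⊛-degLt (x ∷ p) q zero    j lp lq n       l = ⊛-zeroˡ (x ∷ p) q (λ k → lp k z≤n) n
⊛-degLt (x ∷ p) q (suc i) j lp lq (suc n) (s≤s l)
  rewrite coeff-∷⊛-suc x p q n | lq (suc n) (ℕP.≤-trans (ℕP.m≤n+m j i) (ℕP.m≤n⇒m≤1+n l))
        | ⊛-degLt p q i j (λ k i≤k → lp (suc k) (s≤s i≤k)) lq n l
  = trans (ℤP.+-identityʳ _) (ℤP.*-zeroʳ x)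

strip-degLt : ∀ p → DegLt p (length (strip p))
strip-degLt []      n _ = refl
strip-degLt (x ∷ p) n l with strip p | strip-degLt p
strip-degLt (+ zero ∷ p)   zero    _       | []    | tail-zero  = refl
strip-degLt (+ zero ∷ p)   (suc n) _       | []    | tail-zero  = tail-zero n z≤n
strip-degLt (+ suc k ∷ p)  (suc n) _       | []    | tail-zero  = tail-zero n z≤n
strip-degLt (-[1+ k ] ∷ p) (suc n) _       | []    | tail-zero  = tail-zero n z≤n
strip-degLt (x ∷ p)        (suc n) (s≤s l) | _ ∷ _ | tail-bound = tail-bound n l

deg-degLt : ∀ p → DegLt p (suc (deg p))
deg-degLt p = degLt-mono p (ℕP.m≤n+m∸n (length (strip p)) 1) (strip-degLt p)

above : ℕ → Poly → Poly
above zero    a       = a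
above (suc s) []      = []
above (suc s) (x ∷ a) = + 0 ∷ above s a

coeff-take : ∀ s a n → n <ℕ s → coeff (take s a) n ≡ coeff a n
coeff-take (suc s) []      n       l       = refl
coeff-take (suc s) (x ∷ a) zero    l       = refl
coeff-take (suc s) (x ∷ a) (suc n) (s≤s l) = coeff-take s a n l

take-degLt : ∀ s a → DegLt (take s a) s
take-degLt zero    a       n       l       = refl
take-degLt (suc s) []      n       l       = refl
take-degLt (suc s) (x ∷ a) (suc n) (s≤s l) = take-degLt s a n l

∣-above : ∀ s a → x^ s ∣ above s a
∣-above (suc s) []      n       l       = refl
∣-above (suc s) (x ∷ a) zero    l       = refl
∣-above (suc s) (x ∷ a) (suc n) (s≤s l) = ∣-above s a n l

coeff-above : ∀ s a n → s ≤ℕ n → coeff (above s a) n ≡ coeff a n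
coeff-above zero    a       n       l       = refl
coeff-above (suc s) []      n       l       = refl
coeff-above (suc s) (x ∷ a) (suc n) (s≤s l) = coeff-above s a n l

above-degLt : ∀ s a m → DegLt a m → DegLt (above s a) m
above-degLt s a m lt n m≤n with n ℕP.<? s
... | yes n<s = ∣-above s a n n<s
... | no  n≮s = trans (coeff-above s a n (ℕP.≮⇒≥ n≮s)) (lt n m≤n)

above-take : ∀ s t a n → n <ℕ t → coeff (above s (take t a)) n ≡ coeff (above s a) n
above-take zero    t       a       n       l       = coeff-take t a n l
above-take (suc s) (suc t) []      n       l       = refl
above-take (suc s) (suc t) (x ∷ a) zero    l       = refl
above-take (suc s) (suc t) (x ∷ a) (suc n) (s≤s l) = above-take s t a n l

take⊕above : ∀ s a → a ≈ take s a ⊕ above s a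
take⊕above s a n = trans (split s a n) (sym (coeff-⊕ (take s a) (above s a) n))
  where
  split : ∀ s a n → coeff a n ≡ coeff (take s a) n +ℤ coeff (above s a) n
  split zero    a       n       = sym (ℤP.+-identityˡ _)
  split (suc s) []      n       = refl
  split (suc s) (x ∷ a) zero    = sym (ℤP.+-identityʳ _)
  split (suc s) (x ∷ a) (suc n) = split s a n

take-exact : ∀ s a → above s a ≈ [] → a ≈ take s a
take-exact s a tail≈0 n = trans (take⊕above s a n) (⊕-zeroʳ (take s a) tail≈0 n)

‖‖-take-above : ∀ s a → ‖ a ‖ ≡ ‖ take s a ‖ +ℕ ‖ above s a ‖
‖‖-take-above zero    a       = refl
‖‖-take-above (suc s) []      = refl
‖‖-take-above (suc s) (x ∷ a) rewrite ‖‖-take-above s a = sym (ℕP.+-assoc (∣ x ∣ *ℕ ∣ x ∣) _ _)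

‖‖-above-window : ∀ s t a → s ≤ℕ t → ‖ above s a ‖ ≡ ‖ above s (take t a) ‖ +ℕ ‖ above t a ‖
‖‖-above-window zero    t       a       l       = ‖‖-take-above t a
‖‖-above-window (suc s) (suc t) []      l       = refl
‖‖-above-window (suc s) (suc t) (x ∷ a) (s≤s l) = ‖‖-above-window s t a l

‖‖≡0⇒zero : ∀ p → ‖ p ‖ ≡ 0 → p ≈ []
‖‖≡0⇒zero []      e n       = refl
‖‖≡0⇒zero (x ∷ p) e zero    = ℤP.∣i∣≡0⇒i≡0 ([ id , id ]′ (ℕP.m*n≡0⇒m≡0∨n≡0 ∣ x ∣ (ℕP.m+n≡0⇒m≡0 _ e)))
‖‖≡0⇒zero (x ∷ p) e (suc n) = ‖‖≡0⇒zero p (ℕP.m+n≡0⇒n≡0 (∣ x ∣ *ℕ ∣ x ∣) e) n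

‖‖-pos : ∀ p → coeff p 0 ≢ + 0 → 1 ≤ℕ ‖ p ‖
‖‖-pos []      p₀≢0 = ⊥-elim (p₀≢0 refl)
‖‖-pos (x ∷ p) x≢0  = ℕP.≤-trans (ℕP.*-mono-≤ ∣x∣≥1 ∣x∣≥1) (ℕP.m≤m+n _ ‖ p ‖)
  where
  ∣x∣≥1 : 1 ≤ℕ ∣ x ∣
  ∣x∣≥1 = ℕP.n≢0⇒n>0 (λ ∣x∣≡0 → x≢0 (ℤP.∣i∣≡0⇒i≡0 ∣x∣≡0))

‖take‖-pos : ∀ s p → coeff p 0 ≢ + 0 → 1 ≤ℕ ‖ take (suc s) p ‖
‖take‖-pos s p p₀≢0 = ‖‖-pos (take (suc s) p) (λ e → p₀≢0 (trans (sym (coeff-take (suc s) p 0 (s≤s z≤n))) e))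

-- (1) Gap search by repeated doubling.

module GapSearch (a b : Poly) where

  weightFrom : ℕ → ℕ
  weightFrom s = ‖ above s a ‖ +ℕ ‖ above s b ‖

  windowWeight : ℕ → ℕ
  windowWeight s = ‖ above s (take (s +ℕ s) a) ‖ +ℕ ‖ above s (take (s +ℕ s) b) ‖

  Gap : ℕ → Set
  Gap s = x^ (s +ℕ s) ∣ above s a × x^ (s +ℕ s) ∣ above s b

  weight-doubling : ∀ s → weightFrom s ≡ windowWeight s +ℕ weightFrom (s +ℕ s)
  weight-doubling s
    rewrite ‖‖-above-window s (s +ℕ s) a (ℕP.m≤m+n s s) | ‖‖-above-window s (s +ℕ s) b (ℕP.m≤m+n s s)
    = rearrange (‖ above s (take (s +ℕ s) a) ‖) (‖ above (s +ℕ s) a ‖)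
                (‖ above s (take (s +ℕ s) b) ‖) (‖ above (s +ℕ s) b ‖)
    where
    rearrange : ∀ x y z w → (x +ℕ y) +ℕ (z +ℕ w) ≡ (x +ℕ z) +ℕ (y +ℕ w)
    rearrange = ℕSolver.solve-∀

  window-gap : ∀ s → windowWeight s ≡ 0 → Gap s
  window-gap s e = in-window a (ℕP.m+n≡0⇒m≡0 _ e) , in-window b (ℕP.m+n≡0⇒n≡0 _ e)
    where
    in-window : ∀ p → ‖ above s (take (s +ℕ s) p) ‖ ≡ 0 → x^ (s +ℕ s) ∣ above s p
    in-window p e n l = trans (sym (above-take s (s +ℕ s) p n l)) (‖‖≡0⇒zero (above s (take (s +ℕ s) p)) e n)

  weight-drop : ∀ s → windowWeight s ≢ 0 → weightFrom (s +ℕ s) <ℕ weightFrom s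
  weight-drop s ne = ℕP.≤-trans (ℕP.+-monoˡ-≤ (weightFrom (s +ℕ s)) (ℕP.n≢0⇒n>0 ne))
                                (ℕP.≤-reflexive (sym (weight-doubling s)))

  find-gap : ∀ k s → weightFrom s ≤ℕ k → Σ ℕ (λ t → s ≤ℕ t × t ≤ℕ s *ℕ 2 ^ k × Gap t)
  find-gap k s w with windowWeight s ℕP.≟ 0
  ... | yes empty = s , ℕP.≤-refl , ℕP.m≤m*n s (2 ^ k) {{ℕP.m^n≢0 2 k}} , window-gap s empty
  find-gap zero s w | no nonempty = ⊥-elim (ℕP.n≮0 (ℕP.<-≤-trans (weight-drop s nonempty) w))
  find-gap (suc k) s w | no nonempty
    with find-gap k (s +ℕ s) (ℕP.≤-pred (ℕP.<-≤-trans (weight-drop s nonempty) w))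
  ... | t , s+s≤t , t≤ , gap =
    t , ℕP.≤-trans (ℕP.m≤m+n s s) s+s≤t , ℕP.≤-trans t≤ (ℕP.≤-reflexive (doubling s (2 ^ k))) , gap
    where
    doubling : ∀ x y → (x +ℕ x) *ℕ y ≡ x *ℕ (2 *ℕ y)
    doubling = ℕSolver.solve-∀

-- (2) Below a gap, the product only sees the truncations.

-- If a and b have no terms in degrees [s, 2s), then ab ≡ a|_s · b|_s (mod x^(2s)):
-- every product involving a tail starts at degree 2s or later.
gap-product : ∀ a b s → GapSearch.Gap a b s → AgreeBelow (s +ℕ s) (a ⊛ b) (take s a ⊛ take s b)
gap-product a b s (gap-a , gap-b) n l = begin
  coeff (a ⊛ b) n                           ≡⟨ ⊛-expand a a₁ a₂ b b₁ b₂ (take⊕above s a) (take⊕above s b) n ⟩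
  coeff ((a₁ ⊛ b₁ ⊕ a₁ ⊛ b₂) ⊕ (a₂ ⊛ b₁ ⊕ a₂ ⊛ b₂)) n
                                            ≡⟨ coeff-⊕ (a₁ ⊛ b₁ ⊕ a₁ ⊛ b₂) (a₂ ⊛ b₁ ⊕ a₂ ⊛ b₂) n ⟩
  coeff (a₁ ⊛ b₁ ⊕ a₁ ⊛ b₂) n +ℤ coeff (a₂ ⊛ b₁ ⊕ a₂ ⊛ b₂) n
                                            ≡⟨ cong₂ _+ℤ_ (coeff-⊕ (a₁ ⊛ b₁) (a₁ ⊛ b₂) n) (coeff-⊕ (a₂ ⊛ b₁) (a₂ ⊛ b₂) n) ⟩
  (coeff (a₁ ⊛ b₁) n +ℤ coeff (a₁ ⊛ b₂) n) +ℤ (coeff (a₂ ⊛ b₁) n +ℤ coeff (a₂ ⊛ b₂) n)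
                                            ≡⟨ cong₂ (λ u v → (coeff (a₁ ⊛ b₁) n +ℤ u) +ℤ v)
                                                 (∣-⊛ʳ (s +ℕ s) a₁ b₂ gap-b n l)
                                                 (cong₂ _+ℤ_ (∣-⊛ˡ (s +ℕ s) a₂ b₁ gap-a n l)
                                                             (∣-⊛ˡ (s +ℕ s) a₂ b₂ gap-a n l)) ⟩
  (coeff (a₁ ⊛ b₁) n +ℤ + 0) +ℤ + 0         ≡⟨ trans (ℤP.+-identityʳ _) (ℤP.+-identityʳ _) ⟩
  coeff (a₁ ⊛ b₁) n                         ∎
  where
  open ≡-Reasoning
  a₁ a₂ b₁ b₂ : Poly
  a₁ = take s a
  a₂ = above s a
  b₁ = take s b
  b₂ = above s b

truncations-factor : ∀ c d a b s m → 1 +ℕ deg c +ℕ deg d ≤ℕ s → s +ℕ s ≤ℕ m →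
  GapSearch.Gap a b s → AgreeBelow m (a ⊛ b) (c ⊛ d) → take s a ⊛ take s b ≈ c ⊛ d
truncations-factor c d a b s m L≤s s+s≤m gap ab≡cd n with n ℕP.<? s +ℕ s
... | yes n<2s = trans (sym (gap-product a b s gap n n<2s)) (ab≡cd n (ℕP.<-≤-trans n<2s s+s≤m))
... | no  n≮2s = trans (⊛-degLt (take s a) (take s b) s s (take-degLt s a) (take-degLt s b) n 2s≤n)
                       (sym (⊛-degLt c d _ _ (deg-degLt c) (deg-degLt d) n (ℕP.≤-trans deg-cd≤2s 2s≤n)))
  where
  2s≤n : s +ℕ s ≤ℕ n
  2s≤n = ℕP.≮⇒≥ n≮2s
  deg-cd≤2s : suc (deg c) +ℕ suc (deg d) ≤ℕ s +ℕ s
  deg-cd≤2s = ℕP.≤-trans (ℕP.≤-reflexive (cong suc (ℕP.+-suc (deg c) (deg d))))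
                         (ℕP.+-mono-≤ (ℕP.≤-trans (s≤s z≤n) L≤s) L≤s)

-- (3) Absorbing a tail.

absorb-tailˡ : ∀ m p₁ p₂ q e → coeff q 0 ≢ + 0 → DegLt p₂ m →
  p₁ ⊛ q ≈ e → AgreeBelow m ((p₁ ⊕ p₂) ⊛ q) e → p₂ ≈ []
absorb-tailˡ m p₁ p₂ q e q₀≢0 lt p₁q≈e agree =
  ∣-degLt⇒zero m p₂ (unit-cancelˡ m p₂ q q₀≢0 p₂q≡0) lt
  where
  p₂q≡0 : x^ m ∣ p₂ ⊛ q
  p₂q≡0 n l = identityʳ-unique (coeff e n) (coeff (p₂ ⊛ q) n)
    (trans (sym (cong (_+ℤ coeff (p₂ ⊛ q) n) (p₁q≈e n)))
           (trans (sym (coeff-⊕ (p₁ ⊛ q) (p₂ ⊛ q) n)) (trans (sym (⊛-distribʳ p₁ p₂ q n)) (agree n l))))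

absorb-tailʳ : ∀ m q p₁ p₂ e → coeff q 0 ≢ + 0 → DegLt p₂ m →
  q ⊛ p₁ ≈ e → AgreeBelow m (q ⊛ (p₁ ⊕ p₂)) e → p₂ ≈ []
absorb-tailʳ m q p₁ p₂ e q₀≢0 lt qp₁≈e agree =
  ∣-degLt⇒zero m p₂ (unit-cancelʳ m p₂ q q₀≢0 qp₂≡0) lt
  where
  qp₂≡0 : x^ m ∣ q ⊛ p₂
  qp₂≡0 n l = identityʳ-unique (coeff e n) (coeff (q ⊛ p₂) n)
    (trans (sym (cong (_+ℤ coeff (q ⊛ p₂) n) (qp₁≈e n)))
           (trans (sym (coeff-⊕ (q ⊛ p₁) (q ⊛ p₂) n)) (trans (sym (⊛-distribˡ q p₁ p₂ n)) (agree n l))))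

one-tail-vanishes : ∀ N u₁ u₂ v₁ v₂ → N ∸ℕ 1 ≤ℕ u₁ +ℕ v₁ →
  (u₁ +ℕ u₂) +ℕ (v₁ +ℕ v₂) ≤ℕ N → u₂ ≡ 0 ⊎ v₂ ≡ 0
one-tail-vanishes N u₁ u₂ v₁ v₂ robust light = at-most-one u₂ v₂ tails≤1
  where
  rearrange : ∀ x y z w → (x +ℕ y) +ℕ (z +ℕ w) ≡ (x +ℕ z) +ℕ (y +ℕ w)
  rearrange = ℕSolver.solve-∀
  tails≤1 : u₂ +ℕ v₂ ≤ℕ 1
  tails≤1 = ℕP.+-cancelˡ-≤ (u₁ +ℕ v₁) _ _ (begin
    (u₁ +ℕ v₁) +ℕ (u₂ +ℕ v₂)  ≡⟨ rearrange u₁ v₁ u₂ v₂ ⟩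
    (u₁ +ℕ u₂) +ℕ (v₁ +ℕ v₂)  ≤⟨ light ⟩
    N                         ≤⟨ ℕP.m≤n+m∸n N 1 ⟩
    1 +ℕ (N ∸ℕ 1)             ≤⟨ ℕP.+-monoʳ-≤ 1 robust ⟩
    1 +ℕ (u₁ +ℕ v₁)           ≡⟨ ℕP.+-comm 1 (u₁ +ℕ v₁) ⟩
    (u₁ +ℕ v₁) +ℕ 1           ∎)
    where open ℕP.≤-Reasoning
  at-most-one : ∀ x y → x +ℕ y ≤ℕ 1 → x ≡ 0 ⊎ y ≡ 0
  at-most-one zero    y       _       = inj₁ refl
  at-most-one (suc x) zero    _       = inj₂ refl
  at-most-one (suc x) (suc y) (s≤s l) rewrite ℕP.+-suc x y with l
  ... | ()

module LightFactorisation (c d : Poly) (c₀≢0 : coeff c 0 ≢ + 0) (d₀≢0 : coeff d 0 ≢ + 0)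
                          (robust : WeaklyRobust c d) where

  N L : ℕ
  N = ‖ c ‖ +ℕ ‖ d ‖
  L = 1 +ℕ deg c +ℕ deg d

  N≥2 : 2 ≤ℕ N
  N≥2 = ℕP.+-mono-≤ (‖‖-pos c c₀≢0) (‖‖-pos d d₀≢0)

  window-fits : ∀ s → s ≤ℕ L *ℕ 2 ^ (N ∸ℕ 2) → s +ℕ s ≤ℕ L *ℕ 2 ^ (N ∸ℕ 1)
  window-fits s s≤ = ℕP.≤-trans (ℕP.+-mono-≤ s≤ s≤) (ℕP.≤-reflexive (doubling N N≥2))
    where
    doubling : ∀ N → 2 ≤ℕ N → L *ℕ 2 ^ (N ∸ℕ 2) +ℕ L *ℕ 2 ^ (N ∸ℕ 2) ≡ L *ℕ 2 ^ (N ∸ℕ 1)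
    doubling (suc zero)    (s≤s ())
    doubling (suc (suc k)) _ = twice L (2 ^ k)
      where
      twice : ∀ x y → x *ℕ y +ℕ x *ℕ y ≡ x *ℕ (2 *ℕ y)
      twice = ℕSolver.solve-∀

  module _ (a b : Poly) (a₀≢0 : coeff a 0 ≢ + 0) (b₀≢0 : coeff b 0 ≢ + 0) where
    open GapSearch a b

    -- The nonzero constant terms lie below x^L, so at most N - 2 weight remains above.
    initial-weight : ‖ a ‖ +ℕ ‖ b ‖ ≤ℕ N → weightFrom L ≤ℕ N ∸ℕ 2
    initial-weight light = ℕP.m+n≤o⇒m≤o∸n (weightFrom L) (begin
      weightFrom L +ℕ 2                                  ≡⟨ rearrange (‖ above L a ‖) (‖ above L b ‖) ⟩
      (1 +ℕ ‖ above L a ‖) +ℕ (1 +ℕ ‖ above L b ‖)       ≤⟨ ℕP.+-mono-≤ (ℕP.+-monoˡ-≤ _ (‖take‖-pos _ a a₀≢0))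
                                                                         (ℕP.+-monoˡ-≤ _ (‖take‖-pos _ b b₀≢0)) ⟩
      (‖ take L a ‖ +ℕ ‖ above L a ‖) +ℕ (‖ take L b ‖ +ℕ ‖ above L b ‖)
                                                         ≡⟨ sym (cong₂ _+ℕ_ (‖‖-take-above L a) (‖‖-take-above L b)) ⟩
      ‖ a ‖ +ℕ ‖ b ‖                                     ≤⟨ light ⟩
      N                                                  ∎)
      where
      open ℕP.≤-Reasoning
      rearrange : ∀ x y → (x +ℕ y) +ℕ 2 ≡ (1 +ℕ x) +ℕ (1 +ℕ y)
      rearrange = ℕSolver.solve-∀

    exact-at-gap : ∀ m s → L ≤ℕ s → s +ℕ s ≤ℕ m → Gap s → DegLt a m → DegLt b m →
      AgreeBelow m (a ⊛ b) (c ⊛ d) → ‖ a ‖ +ℕ ‖ b ‖ ≤ℕ N → a ⊛ b ≈ c ⊛ d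
    exact-at-gap m s L≤s s+s≤m gap deg-a deg-b ab≡cd light =
      [ (λ ‖a₂‖≡0 → let a₂≈0 = ‖‖≡0⇒zero a₂ ‖a₂‖≡0 in exact a₂≈0 (b-tail a₂≈0))
      , (λ ‖b₂‖≡0 → let b₂≈0 = ‖‖≡0⇒zero b₂ ‖b₂‖≡0 in exact (a-tail b₂≈0) b₂≈0) ]′
        (one-tail-vanishes N (‖ a₁ ‖) (‖ a₂ ‖) (‖ b₁ ‖) (‖ b₂ ‖) (robust a₁ b₁ factor) light-parts)
      where
      a₁ a₂ b₁ b₂ : Poly
      a₁ = take s a
      a₂ = above s a
      b₁ = take s b
      b₂ = above s b

      light-parts : (‖ a₁ ‖ +ℕ ‖ a₂ ‖) +ℕ (‖ b₁ ‖ +ℕ ‖ b₂ ‖) ≤ℕ N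
      light-parts = ℕP.≤-trans (ℕP.≤-reflexive (sym (cong₂ _+ℕ_ (‖‖-take-above s a) (‖‖-take-above s b)))) light

      factor : a₁ ⊛ b₁ ≈ c ⊛ d
      factor = truncations-factor c d a b s m L≤s s+s≤m gap ab≡cd

      0<s : 0 <ℕ s
      0<s = ℕP.≤-trans (s≤s z≤n) L≤s

      a₁₀≢0 : coeff a₁ 0 ≢ + 0
      a₁₀≢0 e = a₀≢0 (trans (sym (coeff-take s a 0 0<s)) e)

      b₁₀≢0 : coeff b₁ 0 ≢ + 0
      b₁₀≢0 e = b₀≢0 (trans (sym (coeff-take s b 0 0<s)) e)

      -- If b has no tail, b₁ cancels and a's tail is absorbed; symmetrically for a.
      a-tail : b₂ ≈ [] → a₂ ≈ []
      a-tail b₂≈0 = absorb-tailˡ m a₁ a₂ b₁ (c ⊛ d) b₁₀≢0 (above-degLt s a m deg-a) factor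
        (λ n l → trans (sym (trans (⊛-congˡ a (a₁ ⊕ a₂) b (take⊕above s a) n)
                                   (⊛-congʳ (a₁ ⊕ a₂) b b₁ (take-exact s b b₂≈0) n)))
                       (ab≡cd n l))

      b-tail : a₂ ≈ [] → b₂ ≈ []
      b-tail a₂≈0 = absorb-tailʳ m a₁ b₁ b₂ (c ⊛ d) a₁₀≢0 (above-degLt s b m deg-b) factor
        (λ n l → trans (sym (trans (⊛-congˡ a a₁ b (take-exact s a a₂≈0) n)
                                   (⊛-congʳ a₁ b (b₁ ⊕ b₂) (take⊕above s b) n)))
                       (ab≡cd n l))

      exact : a₂ ≈ [] → b₂ ≈ [] → a ⊛ b ≈ c ⊛ d
      exact a₂≈0 b₂≈0 = begin
        a ⊛ b    ≈⟨ ⊛-congˡ a a₁ b (take-exact s a a₂≈0) ⟩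
        a₁ ⊛ b   ≈⟨ ⊛-congʳ a₁ b b₁ (take-exact s b b₂≈0) ⟩
        a₁ ⊛ b₁  ≈⟨ factor ⟩
        c ⊛ d    ∎
        where open SetoidReasoning ≈-setoid

  -- Since ab ≡ cd (mod x^m) with m > 0, a(0)·b(0) = c(0)·d(0) ≠ 0.
  constant-terms : ∀ m a b → 0 <ℕ m → AgreeBelow m (a ⊛ b) (c ⊛ d) →
    coeff a 0 ≢ + 0 × coeff b 0 ≢ + 0
  constant-terms m a b 0<m ab≡cd =
    (λ a₀≡0 → ab₀≢0 (cong (_*ℤ coeff b 0) a₀≡0)) ,
    (λ b₀≡0 → ab₀≢0 (trans (cong (coeff a 0 *ℤ_) b₀≡0) (ℤP.*-zeroʳ (coeff a 0))))
    where
    ab₀≢0 : coeff a 0 *ℤ coeff b 0 ≢ + 0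
    ab₀≢0 ab₀≡0 = [ c₀≢0 , d₀≢0 ]′ (ℤP.i*j≡0⇒i≡0∨j≡0 (coeff c 0) cd₀≡0)
      where
      open ≡-Reasoning
      cd₀≡0 : coeff c 0 *ℤ coeff d 0 ≡ + 0
      cd₀≡0 = begin
        coeff c 0 *ℤ coeff d 0  ≡⟨ sym (lowest-coeffˡ 0 c d (λ _ ())) ⟩
        coeff (c ⊛ d) 0         ≡⟨ sym (ab≡cd 0 0<m) ⟩
        coeff (a ⊛ b) 0         ≡⟨ lowest-coeffˡ 0 a b (λ _ ()) ⟩
        coeff a 0 *ℤ coeff b 0  ≡⟨ ab₀≡0 ⟩
        + 0                     ∎

  light⇒exact : ∀ m a b → L *ℕ 2 ^ (N ∸ℕ 1) <ℕ m → DegLt a m → DegLt b m →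
    AgreeBelow m (a ⊛ b) (c ⊛ d) → ‖ a ‖ +ℕ ‖ b ‖ ≤ℕ N → a ⊛ b ≈ c ⊛ d
  light⇒exact m a b m₀<m deg-a deg-b ab≡cd light
    with constant-terms m a b (ℕP.≤-<-trans z≤n m₀<m) ab≡cd
  ... | a₀≢0 , b₀≢0 with GapSearch.find-gap a b (N ∸ℕ 2) L (initial-weight a b a₀≢0 b₀≢0 light)
  ... | s , L≤s , s≤ , gap = exact-at-gap a b a₀≢0 b₀≢0 m s L≤s
          (ℕP.<⇒≤ (ℕP.≤-<-trans (window-fits s s≤) m₀<m)) gap deg-a deg-b ab≡cd light

corollary4p4 : (c d : Poly) → coeff c 0 ≢ + 0 → coeff d 0 ≢ + 0 → WeaklyRobust c d →
    Σ ℤ (λ m₀ → (m₀ ≤ + ((1 +ℕ deg c +ℕ deg d) *ℕ (2 ^ ((‖ c ‖ +ℕ ‖ d ‖) ∸ℕ 1))))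
      × (∀ (m : ℕ) → m₀ < + m → ∀ (a b : Poly) → DegLt a m → DegLt b m →
           (a ⊛ b) ∣ₜ m ≈ c ⊛ d →
           (a ⊛ b ≈ c ⊛ d) ⊎ (‖ c ‖ +ℕ ‖ d ‖ <ℕ ‖ a ‖ +ℕ ‖ b ‖)))
corollary4p4 c d c₀≢0 d₀≢0 robust = + (L *ℕ 2 ^ (N ∸ℕ 1)) , ℤP.≤-refl , exact-or-heavy
  where
  open LightFactorisation c d c₀≢0 d₀≢0 robust
  exact-or-heavy : ∀ m → + (L *ℕ 2 ^ (N ∸ℕ 1)) < + m → ∀ a b → DegLt a m → DegLt b m →
    (a ⊛ b) ∣ₜ m ≈ c ⊛ d → (a ⊛ b ≈ c ⊛ d) ⊎ (N <ℕ ‖ a ‖ +ℕ ‖ b ‖)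
  exact-or-heavy m m₀<m a b deg-a deg-b truncated with N ℕP.<? ‖ a ‖ +ℕ ‖ b ‖
  ... | yes heavy = inj₂ heavy
  ... | no  light = inj₁ (light⇒exact m a b (ℤP.drop‿+<+ m₀<m) deg-a deg-b ab≡cd (ℕP.≮⇒≥ light))
    where
    ab≡cd : AgreeBelow m (a ⊛ b) (c ⊛ d)
    ab≡cd n n<m = trans (sym (coeff-take m (a ⊛ b) n n<m)) (truncated n)
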